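{- Let $(X,p)$ be a context-free grammar in Greibach normal form over a finite alphabet $A$, let $s,t\in X^*$ and $a\in A$. If $t\in\{s\}_a$ with respect to the grammar automaton generated from $(X,p)$, then $s\Rightarrow^* at$.
   Context: A context-free grammar $(X,p)$ has a finite set $X$ of nonterminals (disjoint from $A$) and $p:X\to\mathcal{P}_\omega((A+X)^*)$; write $x\to u$ for $u\in p(x)$. $v\Rightarrow w$ if $v=v_1xv_2$, $w=v_1uv_2$ with $x\to u$; $\Rightarrow^*$ is its reflexive transitive closure. Greibach normal form: every production is $x\to aw$ ($a\in A$, $w\in X^*$) or $x\to\epsilon$. The grammar coalgebra: $o(x)=1$ iff $x\to\epsilon$, $x_a=\{w\in X^*\mid x\to aw\}$. With $i(1)=\{\epsilon\}$, $i(0)=\emptyset$, the grammar automaton is the coalgebra $(\hat o,\hat\delta)$ on $\mathcal{P}_\omega(X^*)$ (write $S_a=\hat\delta(S)(a)$): $\hat o(\{\epsilon\})=1$, $\{\epsilon\}_a=\emptyset$; for $x\in X$, $w\in X^*$: $\hat o(\{xw\})=o(x)\wedge\hat o(\{w\})$, $\{xw\}_a=x_a\{w\}\cup i(o(x))\{w\}_a$ (language concatenation); for finite $S$: $\hat o(S)=\bigvee_{s\in S}\hat o(\{s\})$, $S_a=\bigcup_{s\in S}\{s\}_a$. -}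

module Defs where

open import Data.Nat using (ℕ)
open import Data.Fin using (Fin)
open import Data.Sum using (_⊎_; inj₁; inj₂)
open import Data.Product using (_×_; ∃; ∃-syntax)
open import Data.List using (List; []; _∷_; _++_; map)
open import Data.List.Membership.Propositional using (_∈_)
open import Data.Empty using (⊥)
open import Relation.Binary.PropositionalEquality using (_≡_)
open import Relation.Binary.Construct.Closure.ReflexiveTransitive using (Star)

-- A context-free grammar over the finite alphabet A = Fin nA with finite
-- set of nonterminals X = Fin nX.  p x is the finite set of right-hand sides
-- (as a list); symbols are A + X.
record Grammar (nA nX : ℕ) : Set where
  field
    p : Fin nX → List (List (Fin nA ⊎ Fin nX))

module _ {nA nX : ℕ} (G : Grammar nA nX) where
  open Grammar G

  Sym : Set
  Sym = Fin nA ⊎ Fin nX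

  _⟶_ : Fin nX → List Sym → Set
  x ⟶ u = u ∈ p x

  data _⇒_ : List Sym → List Sym → Set where
    step : ∀ v₁ x u v₂ → x ⟶ u →
           (v₁ ++ inj₂ x ∷ v₂) ⇒ (v₁ ++ u ++ v₂)

  _⇒*_ : List Sym → List Sym → Set
  _⇒*_ = Star _⇒_

  GreibachNF : Set
  GreibachNF = ∀ x u → x ⟶ u →
    (u ≡ []) ⊎ (∃[ a ] ∃[ w ] (u ≡ inj₁ a ∷ map inj₂ w))

  o : Fin nX → Set
  o x = x ⟶ []

  _∈x[_]_ : List (Fin nX) → Fin nX → Fin nA → Set
  w ∈x[ x ] a = x ⟶ (inj₁ a ∷ map inj₂ w)

  -- membership in {s}_a for the grammar automaton on P_ω(X*):
  --   {ε}_a = ∅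
  --   {x w}_a = x_a {w} ∪ i(o(x)) {w}_a
  _∈δ[_]_ : List (Fin nX) → List (Fin nX) → Fin nA → Set
  t ∈δ[ [] ] a = ⊥
  t ∈δ[ x ∷ w ] a =
      (∃[ u ] (u ∈x[ x ] a × t ≡ u ++ w))
    ⊎ (o x × t ∈δ[ w ] a)

module Submission where

open import Defs
open import Data.Nat using (ℕ)
open import Data.Fin using (Fin)
open import Data.Sum using (inj₁; inj₂)
open import Data.List using (List; []; _∷_; map; _++_)
open import Data.List.Properties using (map-++)
open import Data.Product using (_,_)
open import Relation.Binary.PropositionalEquality using (refl; subst; sym)
open import Relation.Binary.Construct.Closure.ReflexiveTransitive using (ε; _◅_)

module _ {nA nX : ℕ} (G : Grammar nA nX) where

  rewrite-head : ∀ x u w → _⟶_ G x u →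
    _⇒_ G (map inj₂ (x ∷ w)) (u ++ map inj₂ w)
  rewrite-head x u w = step [] x u (map inj₂ w)

  ∈δ⇒derives : ∀ s t a → _∈δ[_]_ G t s a →
    _⇒*_ G (map inj₂ s) (inj₁ a ∷ map inj₂ t)
  ∈δ⇒derives (x ∷ w) t a (inj₁ (u , x→au , refl)) =
    subst (λ v → _⇒*_ G (map inj₂ (x ∷ w)) (inj₁ a ∷ v)) (sym (map-++ inj₂ u w))
      (rewrite-head x (inj₁ a ∷ map inj₂ u) w x→au ◅ ε)
  ∈δ⇒derives (x ∷ w) t a (inj₂ (x→ε , t∈w_a)) =
    rewrite-head x [] w x→ε ◅ ∈δ⇒derives w t a t∈w_a

lemma3p5 : {nA nX : ℕ} (G : Grammar nA nX) → GreibachNF G →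
    (s t : List (Fin nX)) (a : Fin nA) →
    _∈δ[_]_ G t s a →
    _⇒*_ G (map inj₂ s) (inj₁ a ∷ map inj₂ t)
lemma3p5 G _ = ∈δ⇒derives G
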